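{- Let $k\leq s\leq n$ be natural numbers and suppose $\mathcal{F}\subseteq\binom{[n]}{s}$ has VC-dimension $m$ and the $k$-covering property (as a family of subsets of $[n]$). Then for every natural number $\ell\geq 1$ there is a family of $(s\cdot\ell)$-element subsets of an $(n\cdot\ell)$-element set (e.g. of $[n]\times[\ell]$, identified with $[n\cdot\ell]$) which has VC-dimension $m$ and the $k$-covering property. In particular, for every $k\leq s\leq n$ and every natural number $\ell\geq1$ we have $D(k,s\cdot\ell,n\cdot\ell)\leq D(k,s,n)$.
   Context: For a natural number $n$, $[n]=\{1,\dots,n\}$, and for a set $A$ and $s\in\mathbb{N}$, $\binom{A}{s}$ denotes the set of $s$-element subsets of $A$. A set $A$ is shattered by a family $\mathcal{F}$ of sets if $\{A\cap S: S\in\mathcal{F}\}=2^A$. The VC-dimension of $\mathcal{F}$ is the size of the largest finite set shattered by $\mathcal{F}$. A family $\mathcal{F}\subseteq 2^X$ has the $k$-covering property if every $k$-element subset of $X$ is contained in some member of $\mathcal{F}$. For natural numbers $k\leq s\leq n$, $D(k,s,n)$ denotes the smallest VC-dimension of a family $\mathcal{F}\subseteq\binom{[n]}{s}$ having the $k$-covering property (as subsets of $[n]$). -}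

module Defs where

open import Data.Nat using (ℕ; _≤_)
open import Data.Fin.Subset using (Subset; _⊆_; _∩_; ∣_∣)
open import Data.Product using (Σ; _×_; ∃)
open import Relation.Binary.PropositionalEquality using (_≡_)

Family : ℕ → Set₁
Family n = Subset n → Set

-- A is shattered by F: {A ∩ S : S ∈ F} = 2^A
-- (every subset B of A arises as A ∩ S for some S ∈ F; the other inclusion is automatic).
Shatters : ∀ {n} → Family n → Subset n → Set
Shatters F A = ∀ B → B ⊆ A → ∃ λ S → F S × (A ∩ S ≡ B)

HasVCdim : ∀ {n} → Family n → ℕ → Set
HasVCdim F m =
  (∃ λ A → Shatters F A × ∣ A ∣ ≡ m) × (∀ A → Shatters F A → ∣ A ∣ ≤ m)

Uniform : ∀ {n} → ℕ → Family n → Set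
Uniform s F = ∀ S → F S → ∣ S ∣ ≡ s

Covering : ∀ {n} → ℕ → Family n → Set
Covering k F = ∀ K → ∣ K ∣ ≡ k → ∃ λ S → F S × K ⊆ S

{-# OPTIONS --safe #-}
-- Replace each point of [n] by a block of ℓ points and each member S of F by the
-- union of the blocks over S.  A k-set K lies in the
-- blow-up of its shadow (the set of blocks it meets), which has at most k points
-- and so extends to a k-set covered by F.  Choosing one point per block turns a set
-- shattered by F into one shattered by the blow-up; conversely a set shattered by
-- the blow-up meets every block at most once, since blown-up sets never separate two
-- points of a block, and its shadow is shattered by F.
module Submission where

open import Defs
open import Data.Bool using (_∧_; _∨_)
open import Data.Bool.Properties using (∧-identityʳ; ∧-zeroʳ)
open import Data.Fin.Subset
  using (Subset; Side; inside; outside; ⊥; _∈_; _⊆_; _∩_; ∣_∣)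
open import Data.Fin.Subset.Properties
  using (⊆-refl; ⊆-trans; ⊆-antisym; out⊆; s⊆s; p∩q⊆p; x∈p∩q⁺; x∈p∩q⁻; ∣⊥∣≡0; ∣⊤∣≡n;
         ∩-comm; ∩-identityʳ; ∩-zeroˡ; ∩-zeroʳ)
open import Data.Nat using (ℕ; suc; zero; _+_; _*_; _∸_; _≤_; z≤n; s≤s; s≤s⁻¹)
open import Data.Nat.Properties
  using (≤-trans; ≤-reflexive; +-mono-≤; +-suc; m∸n+n≡m; module ≤-Reasoning)
open import Data.Product using (Σ; ∃; _×_; _,_; proj₂)
open import Data.Vec
  using (Vec; []; _∷_; _++_; replicate; map; zipWith; concat; group; head)
open import Data.Vec.Properties
  using (zipWith-++; zipWith-replicate; ++-injective; ++-injectiveˡ; ++-injectiveʳ;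
         ∷-injectiveˡ; ∷-injectiveʳ)
open import Function using (_∘_)
open import Relation.Binary.PropositionalEquality
  using (_≡_; refl; sym; trans; cong; cong₂; subst; module ≡-Reasoning)

private
  variable
    k m n ℓ : ℕ
    p q : Subset n

∣p++q∣≡∣p∣+∣q∣ : (p : Subset m) (q : Subset n) → ∣ p ++ q ∣ ≡ ∣ p ∣ + ∣ q ∣
∣p++q∣≡∣p∣+∣q∣ []            q = refl
∣p++q∣≡∣p∣+∣q∣ (inside ∷ p)  q = cong suc (∣p++q∣≡∣p∣+∣q∣ p q)
∣p++q∣≡∣p∣+∣q∣ (outside ∷ p) q = ∣p++q∣≡∣p∣+∣q∣ p q

∩-++ : (p p′ : Subset m) (q q′ : Subset n) → (p ++ q) ∩ (p′ ++ q′) ≡ (p ∩ p′) ++ (q ∩ q′)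
∩-++ p p′ q q′ = zipWith-++ _∧_ p q p′ q′

p⊆q⇒p∩q≡p : p ⊆ q → p ∩ q ≡ p
p⊆q⇒p∩q≡p {p = p} {q} p⊆q = ⊆-antisym (p∩q⊆p p q) (λ x∈p → x∈p∩q⁺ (x∈p , p⊆q x∈p))

p∩q≡p⇒p⊆q : p ∩ q ≡ p → p ⊆ q
p∩q≡p⇒p⊆q {p = p} {q} p∩q≡p x∈p = proj₂ (x∈p∩q⁻ p q (subst (_ ∈_) (sym p∩q≡p) x∈p))

⊆-extend : (p : Subset n) (d : ℕ) → d + ∣ p ∣ ≤ n → ∃ λ q → p ⊆ q × ∣ q ∣ ≡ d + ∣ p ∣
⊆-extend []            zero    _       = [] , ⊆-refl , refl
⊆-extend (outside ∷ p) zero    _       = outside ∷ p , ⊆-refl , refl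
⊆-extend (outside ∷ p) (suc d) (s≤s h) with ⊆-extend p d h
... | q , p⊆q , ∣q∣≡ = inside ∷ q , out⊆ p⊆q , cong suc ∣q∣≡
⊆-extend {suc n} (inside ∷ p) d h
  with ⊆-extend p d (s≤s⁻¹ (subst (_≤ suc n) (+-suc d ∣ p ∣) h))
... | q , p⊆q , ∣q∣≡ = inside ∷ q , s⊆s p⊆q , trans (cong suc ∣q∣≡) (sym (+-suc d ∣ p ∣))

⊆-extend-to : (p : Subset n) → ∣ p ∣ ≤ k → k ≤ n → ∃ λ q → p ⊆ q × ∣ q ∣ ≡ k
⊆-extend-to {n} {k} p ∣p∣≤k k≤n
  with ⊆-extend p (k ∸ ∣ p ∣) (subst (_≤ n) (sym (m∸n+n≡m ∣p∣≤k)) k≤n)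
... | q , p⊆q , ∣q∣≡ = q , p⊆q , trans ∣q∣≡ (m∸n+n≡m ∣p∣≤k)

concat-injective : {A : Set} (xss yss : Vec (Vec A m) n) → concat xss ≡ concat yss → xss ≡ yss
concat-injective []         []         _  = refl
concat-injective (xs ∷ xss) (ys ∷ yss) eq =
  cong₂ _∷_ (++-injectiveˡ xs ys eq) (concat-injective xss yss (++-injectiveʳ xs ys eq))

occupied : Subset m → Side
occupied []      = outside
occupied (b ∷ p) = b ∨ occupied p

occupied-⊥ : ∀ m → occupied (⊥ {m}) ≡ outside
occupied-⊥ zero    = refl
occupied-⊥ (suc m) = occupied-⊥ m

∣occupied∣≤∣p∣ : (p : Subset m) → ∣ occupied p ∷ [] ∣ ≤ ∣ p ∣
∣occupied∣≤∣p∣ []            = z≤n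
∣occupied∣≤∣p∣ (inside ∷ p)  = s≤s z≤n
∣occupied∣≤∣p∣ (outside ∷ p) = ∣occupied∣≤∣p∣ p

∩-replicate-occupied : (p : Subset m) → p ∩ replicate m (occupied p) ≡ p
∩-replicate-occupied []            = refl
∩-replicate-occupied (inside ∷ p)  = cong (inside ∷_) (∩-identityʳ p)
∩-replicate-occupied (outside ∷ p) = cong (outside ∷_) (∩-replicate-occupied p)

occupied-∩-replicate : (p : Subset m) (s : Side) → occupied (p ∩ replicate m s) ≡ occupied p ∧ s
occupied-∩-replicate     p inside  = trans (cong occupied (∩-identityʳ p)) (sym (∧-identityʳ _))
occupied-∩-replicate {m} p outside =
  trans (cong occupied (∩-zeroʳ p)) (trans (occupied-⊥ m) (sym (∧-zeroʳ _)))

first : Subset m → Subset m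
first []            = []
first (inside ∷ p)  = inside ∷ ⊥
first (outside ∷ p) = outside ∷ first p

first∩p≡first : (p : Subset m) → first p ∩ p ≡ first p
first∩p≡first []            = refl
first∩p≡first (inside ∷ p)  = cong (inside ∷_) (∩-zeroˡ p)
first∩p≡first (outside ∷ p) = cong (outside ∷_) (first∩p≡first p)

∣first∣≡∣occupied∣ : (p : Subset m) → ∣ first p ∣ ≡ ∣ occupied p ∷ [] ∣
∣first∣≡∣occupied∣ []                     = refl
∣first∣≡∣occupied∣ {suc m} (inside ∷ p)  = cong suc (∣⊥∣≡0 m)
∣first∣≡∣occupied∣ (outside ∷ p)         = ∣first∣≡∣occupied∣ p

first≡⊥⇒p≡⊥ : (p : Subset m) → first p ≡ ⊥ → p ≡ ⊥
first≡⊥⇒p≡⊥ []            _  = refl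
first≡⊥⇒p≡⊥ (inside ∷ p)  ()
first≡⊥⇒p≡⊥ (outside ∷ p) eq = cong (outside ∷_) (first≡⊥⇒p≡⊥ p (∷-injectiveʳ eq))

p∩replicate≡first⇒p≡first : (p : Subset m) (s : Side) → p ∩ replicate m s ≡ first p → p ≡ first p
p∩replicate≡first⇒p≡first p inside  eq = trans (sym (∩-identityʳ p)) eq
p∩replicate≡first⇒p≡first p outside eq =
  trans (first≡⊥⇒p≡⊥ p first≡⊥) (sym first≡⊥)
  where
  first≡⊥ : first p ≡ ⊥
  first≡⊥ = trans (sym eq) (∩-zeroʳ p)

blow : ∀ ℓ → Subset n → Subset (n * ℓ)
blow ℓ S = concat (map (replicate ℓ) S)

Blowup : ∀ ℓ → Family n → Family (n * ℓ)
Blowup ℓ F T = ∃ λ S → F S × blow ℓ S ≡ T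

∣blow∣ : ∀ ℓ (S : Subset n) → ∣ blow ℓ S ∣ ≡ ∣ S ∣ * ℓ
∣blow∣ ℓ []            = refl
∣blow∣ ℓ (inside ∷ S)  =
  trans (∣p++q∣≡∣p∣+∣q∣ (replicate ℓ inside) (blow ℓ S)) (cong₂ _+_ (∣⊤∣≡n ℓ) (∣blow∣ ℓ S))
∣blow∣ ℓ (outside ∷ S) =
  trans (∣p++q∣≡∣p∣+∣q∣ (replicate ℓ outside) (blow ℓ S)) (cong₂ _+_ (∣⊥∣≡0 ℓ) (∣blow∣ ℓ S))

blow-∩ : ∀ ℓ (S T : Subset n) → blow ℓ S ∩ blow ℓ T ≡ blow ℓ (S ∩ T)
blow-∩ ℓ []      []      = refl
blow-∩ ℓ (s ∷ S) (t ∷ T) =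
  trans (∩-++ (replicate ℓ s) _ (blow ℓ S) _)
        (cong₂ _++_ (zipWith-replicate _∧_ s t) (blow-∩ ℓ S T))

blow-mono : ∀ ℓ {S T : Subset n} → S ⊆ T → blow ℓ S ⊆ blow ℓ T
blow-mono ℓ {S} {T} S⊆T = p∩q≡p⇒p⊆q (trans (blow-∩ ℓ S T) (cong (blow ℓ) (p⊆q⇒p∩q≡p S⊆T)))

-- A subset of Fin (n * ℓ) is handled as the concatenation of its n blocks of ℓ
-- consecutive points (recovered by group); block i stands for the point i of [n].
shadow : Vec (Subset ℓ) n → Subset n
shadow = map occupied

restrict : Vec (Subset ℓ) n → Subset n → Vec (Subset ℓ) n
restrict xss S = zipWith (λ x s → x ∩ replicate _ s) xss S

concat-∩-blow : (xss : Vec (Subset ℓ) n) (S : Subset n) →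
                concat xss ∩ blow ℓ S ≡ concat (restrict xss S)
concat-∩-blow []        []      = refl
concat-∩-blow (x ∷ xss) (s ∷ S) =
  trans (∩-++ x _ (concat xss) _) (cong (_ ++_) (concat-∩-blow xss S))

restrict-shadow : (xss : Vec (Subset ℓ) n) → restrict xss (shadow xss) ≡ xss
restrict-shadow []        = refl
restrict-shadow (x ∷ xss) = cong₂ _∷_ (∩-replicate-occupied x) (restrict-shadow xss)

shadow-restrict : (xss : Vec (Subset ℓ) n) (S : Subset n) → shadow (restrict xss S) ≡ shadow xss ∩ S
shadow-restrict []        []      = refl
shadow-restrict (x ∷ xss) (s ∷ S) = cong₂ _∷_ (occupied-∩-replicate x s) (shadow-restrict xss S)

∣shadow∣≤∣concat∣ : (xss : Vec (Subset ℓ) n) → ∣ shadow xss ∣ ≤ ∣ concat xss ∣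
∣shadow∣≤∣concat∣ []        = z≤n
∣shadow∣≤∣concat∣ (x ∷ xss) = begin
  ∣ occupied x ∷ shadow xss ∣          ≡⟨ ∣p++q∣≡∣p∣+∣q∣ (occupied x ∷ []) (shadow xss) ⟩
  ∣ occupied x ∷ [] ∣ + ∣ shadow xss ∣ ≤⟨ +-mono-≤ (∣occupied∣≤∣p∣ x) (∣shadow∣≤∣concat∣ xss) ⟩
  ∣ x ∣ + ∣ concat xss ∣               ≡⟨ sym (∣p++q∣≡∣p∣+∣q∣ x (concat xss)) ⟩
  ∣ x ++ concat xss ∣                  ∎
  where open ≤-Reasoning

firsts∩concat≡firsts : (xss : Vec (Subset ℓ) n) →
                       concat (map first xss) ∩ concat xss ≡ concat (map first xss)
firsts∩concat≡firsts []        = refl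
firsts∩concat≡firsts (x ∷ xss) =
  trans (∩-++ (first x) x _ (concat xss)) (cong₂ _++_ (first∩p≡first x) (firsts∩concat≡firsts xss))

∣firsts∣≡∣shadow∣ : (xss : Vec (Subset ℓ) n) → ∣ concat (map first xss) ∣ ≡ ∣ shadow xss ∣
∣firsts∣≡∣shadow∣ []        = refl
∣firsts∣≡∣shadow∣ (x ∷ xss) = begin
  ∣ first x ++ concat (map first xss) ∣    ≡⟨ ∣p++q∣≡∣p∣+∣q∣ (first x) _ ⟩
  ∣ first x ∣ + ∣ concat (map first xss) ∣ ≡⟨ cong₂ _+_ (∣first∣≡∣occupied∣ x) (∣firsts∣≡∣shadow∣ xss) ⟩
  ∣ occupied x ∷ [] ∣ + ∣ shadow xss ∣     ≡⟨ sym (∣p++q∣≡∣p∣+∣q∣ (occupied x ∷ []) (shadow xss)) ⟩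
  ∣ occupied x ∷ shadow xss ∣              ∎
  where open ≡-Reasoning

restrict≡firsts⇒≡firsts : (xss : Vec (Subset ℓ) n) (S : Subset n) →
                           restrict xss S ≡ map first xss → xss ≡ map first xss
restrict≡firsts⇒≡firsts []        []      _  = refl
restrict≡firsts⇒≡firsts (x ∷ xss) (s ∷ S) eq =
  cong₂ _∷_ (p∩replicate≡first⇒p≡first x s (∷-injectiveˡ eq))
            (restrict≡firsts⇒≡firsts xss S (∷-injectiveʳ eq))

single : Side → Subset (suc m)
single a = a ∷ ⊥

spread : ∀ ℓ → Subset n → Subset (n * suc ℓ)
spread ℓ A = concat (map single A)

∣single∣ : ∀ m (a : Side) → ∣ single {m} a ∣ ≡ ∣ a ∷ [] ∣
∣single∣ m inside  = cong suc (∣⊥∣≡0 m)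
∣single∣ m outside = ∣⊥∣≡0 m

∣spread∣ : ∀ ℓ (A : Subset n) → ∣ spread ℓ A ∣ ≡ ∣ A ∣
∣spread∣ ℓ []      = refl
∣spread∣ ℓ (a ∷ A) = begin
  ∣ single {ℓ} a ++ spread ℓ A ∣    ≡⟨ ∣p++q∣≡∣p∣+∣q∣ (single {ℓ} a) (spread ℓ A) ⟩
  ∣ single {ℓ} a ∣ + ∣ spread ℓ A ∣ ≡⟨ cong₂ _+_ (∣single∣ ℓ a) (∣spread∣ ℓ A) ⟩
  ∣ a ∷ [] ∣ + ∣ A ∣                ≡⟨ sym (∣p++q∣≡∣p∣+∣q∣ (a ∷ []) A) ⟩
  ∣ a ∷ A ∣                         ∎
  where open ≡-Reasoning

spread-∩-blow : ∀ ℓ (A S : Subset n) → spread ℓ A ∩ blow (suc ℓ) S ≡ spread ℓ (A ∩ S)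
spread-∩-blow ℓ []      []      = refl
spread-∩-blow ℓ (a ∷ A) (s ∷ S) =
  trans (∩-++ (single a) _ (spread ℓ A) _)
        (cong₂ _++_ (cong (a ∧ s ∷_) (∩-zeroˡ (replicate ℓ s))) (spread-∩-blow ℓ A S))

p∩single≡p⇒p≡single : (p : Subset (suc m)) (a : Side) →
                       p ∩ single a ≡ p → p ≡ single (head p) × head p ∧ a ≡ head p
p∩single≡p⇒p≡single (b ∷ p) a eq =
  cong (b ∷_) (trans (sym (∷-injectiveʳ eq)) (∩-zeroʳ p)) , ∷-injectiveˡ eq

concat∩spread≡concat⇒spread : (yss : Vec (Subset (suc ℓ)) n) (A : Subset n) →
                       concat yss ∩ spread ℓ A ≡ concat yss →
                       concat yss ≡ spread ℓ (map head yss) × map head yss ∩ A ≡ map head yss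
concat∩spread≡concat⇒spread []        []      _  = refl , refl
concat∩spread≡concat⇒spread (y ∷ yss) (a ∷ A) eq
  with ++-injective (y ∩ single a) y (trans (sym (∩-++ y (single a) (concat yss) _)) eq)
... | y∩a≡y , yss∩A≡yss
  with p∩single≡p⇒p≡single y a y∩a≡y | concat∩spread≡concat⇒spread yss A yss∩A≡yss
... | y≡ , ya≡ | yss≡ , yssA≡ = cong₂ _++_ y≡ yss≡ , cong₂ _∷_ ya≡ yssA≡

⊆-spread⇒spread : ∀ ℓ (B′ : Subset (n * suc ℓ)) (A : Subset n) →
                 B′ ⊆ spread ℓ A → ∃ λ B → B ⊆ A × spread ℓ B ≡ B′
⊆-spread⇒spread {n} ℓ B′ A B′⊆ with group n (suc ℓ) B′
... | yss , refl with concat∩spread≡concat⇒spread yss A (p⊆q⇒p∩q≡p B′⊆)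
... | yss≡ , yssA≡ = map head yss , p∩q≡p⇒p⊆q yssA≡ , sym yss≡

blowup-uniform : ∀ {s} {F : Family n} ℓ → Uniform s F → Uniform (s * ℓ) (Blowup ℓ F)
blowup-uniform ℓ uniform _ (S , S∈F , refl) = trans (∣blow∣ ℓ S) (cong (_* ℓ) (uniform S S∈F))

blowup-covering : ∀ {F : Family n} ℓ → k ≤ n → Covering k F → Covering k (Blowup ℓ F)
blowup-covering {n} ℓ k≤n covering K ∣K∣≡k with group n ℓ K
... | xss , refl
  with ⊆-extend-to (shadow xss) (subst (_ ≤_) ∣K∣≡k (∣shadow∣≤∣concat∣ xss)) k≤n
... | Q , shadow⊆Q , ∣Q∣≡k with covering Q ∣Q∣≡k
... | S , S∈F , Q⊆S =
  blow ℓ S , (S , S∈F , refl) , ⊆-trans K⊆ (blow-mono ℓ (⊆-trans shadow⊆Q Q⊆S))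
  where
  K⊆ : concat xss ⊆ blow ℓ (shadow xss)
  K⊆ = p∩q≡p⇒p⊆q (trans (concat-∩-blow xss (shadow xss)) (cong concat (restrict-shadow xss)))

spread-shattered : ∀ {F : Family n} ℓ {A : Subset n} →
                   Shatters F A → Shatters (Blowup (suc ℓ) F) (spread ℓ A)
spread-shattered ℓ {A} shatters B′ B′⊆ with ⊆-spread⇒spread ℓ B′ A B′⊆
... | B , B⊆A , refl with shatters B B⊆A
... | S , S∈F , A∩S≡B =
  blow (suc ℓ) S , (S , S∈F , refl) , trans (spread-∩-blow ℓ A S) (cong (spread ℓ) A∩S≡B)

shadow-shattered : {F : Family n} (xss : Vec (Subset ℓ) n) →
                   Shatters (Blowup ℓ F) (concat xss) → Shatters F (shadow xss)
shadow-shattered {ℓ = ℓ} xss shatters B B⊆ with shatters (concat xss ∩ blow ℓ B) (p∩q⊆p _ _)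
... | _ , (S , S∈F , refl) , traces≡ = S , S∈F , (begin
  shadow xss ∩ S          ≡⟨ sym (shadow-restrict xss S) ⟩
  shadow (restrict xss S) ≡⟨ cong shadow (concat-injective _ _ blocks≡) ⟩
  shadow (restrict xss B) ≡⟨ shadow-restrict xss B ⟩
  shadow xss ∩ B          ≡⟨ ∩-comm _ B ⟩
  B ∩ shadow xss          ≡⟨ p⊆q⇒p∩q≡p B⊆ ⟩
  B                       ∎)
  where
  open ≡-Reasoning
  blocks≡ : concat (restrict xss S) ≡ concat (restrict xss B)
  blocks≡ = trans (sym (concat-∩-blow xss S)) (trans traces≡ (concat-∩-blow xss B))

-- Realising the trace that keeps only the first point of every block leaves no room
-- for a second point in any block.
∣shattered∣≡∣shadow∣ : {F : Family n} (xss : Vec (Subset ℓ) n) →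
                       Shatters (Blowup ℓ F) (concat xss) → ∣ concat xss ∣ ≡ ∣ shadow xss ∣
∣shattered∣≡∣shadow∣ xss shatters
  with shatters (concat (map first xss)) (p∩q≡p⇒p⊆q (firsts∩concat≡firsts xss))
... | _ , (S , _ , refl) , trace≡ =
  trans (cong (∣_∣ ∘ concat) xss≡firsts) (∣firsts∣≡∣shadow∣ xss)
  where
  blocks≡ : concat (restrict xss S) ≡ concat (map first xss)
  blocks≡ = trans (sym (concat-∩-blow xss S)) trace≡
  xss≡firsts : xss ≡ map first xss
  xss≡firsts = restrict≡firsts⇒≡firsts xss S (concat-injective _ _ blocks≡)

blowup-shattered-bound : ∀ {F : Family n} ℓ → (∀ A → Shatters F A → ∣ A ∣ ≤ m) →
                         ∀ X → Shatters (Blowup ℓ F) X → ∣ X ∣ ≤ m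
blowup-shattered-bound {n} ℓ bound X shatters with group n ℓ X
... | xss , refl =
  ≤-trans (≤-reflexive (∣shattered∣≡∣shadow∣ xss shatters))
          (bound _ (shadow-shattered xss shatters))

blowup-hasVCdim : ∀ {F : Family n} ℓ → HasVCdim F m → HasVCdim (Blowup (suc ℓ) F) m
blowup-hasVCdim ℓ ((A , shatters , ∣A∣≡m) , bound) =
  (spread ℓ A , spread-shattered ℓ shatters , trans (∣spread∣ ℓ A) ∣A∣≡m) ,
  blowup-shattered-bound (suc ℓ) bound

mainTheorem5 : (k s n m : ℕ) → k ≤ s → s ≤ n → (F : Family n) →
    Uniform s F → HasVCdim F m → Covering k F →
    (ℓ : ℕ) → 1 ≤ ℓ →
    Σ (Family (n * ℓ)) λ G → Uniform (s * ℓ) G × HasVCdim G m × Covering k G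
mainTheorem5 k s n m k≤s s≤n F uniform vcdim covering zero    ()
mainTheorem5 k s n m k≤s s≤n F uniform vcdim covering (suc ℓ) _  =
  Blowup (suc ℓ) F ,
  blowup-uniform (suc ℓ) uniform ,
  blowup-hasVCdim ℓ vcdim ,
  blowup-covering (suc ℓ) (≤-trans k≤s s≤n) covering
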